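{- Let $G$ be a triangle-free subdivision of $K_5$, with branch vertices (vertices of degree $4$) $a,b,c,d,e$. Suppose that every induced subgraph of $G$ that is a subdivision of $K_4$ has four vertices $p,q,r,s$ of degree $3$ with $pq,pr\in E$ and $ps,qr\notin E$. Then $G$ is of one of the following forms: (type A) there is a $4$-cycle $C$ on four of the branch vertices such that the four edges of $K_5$ along $C$ are not subdivided at all (they are edges of $G$), and each of the other six edges of $K_5$ is subdivided at least once; (type B) there is a $5$-cycle $C$ on the five branch vertices such that the five edges of $K_5$ along $C$ are not subdivided at all, and each of the other five edges of $K_5$ is subdivided at least once.
   Context: A subdivision of a graph $H$ is obtained by replacing some (possibly none) of its edges by paths of length at least $1$; an edge of $H$ is "subdivided" if it is replaced by a path of length at least $2$. The branch vertices of a subdivision of $K_n$ are the vertices corresponding to the vertices of $K_n$. -}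

module Defs where

open import Data.Nat using (ℕ; zero; suc; _+_)
open import Data.Bool using (Bool; true; false; _∧_; if_then_else_)
open import Data.Fin using (Fin; _<_)
open import Data.List using (List; []; _∷_; _++_; [_]; map; allFin)
open import Data.Nat.ListAction using (sum)
open import Data.List.Membership.Propositional using (_∈_; _∉_)
open import Data.List.Relation.Unary.Linked using (Linked)
open import Data.List.Relation.Unary.Unique.Propositional using (Unique)
open import Data.Product using (Σ; ∃; ∃-syntax; _×_; _,_)
open import Data.Sum using (_⊎_)
open import Data.Empty using (⊥)
open import Relation.Nullary using (¬_)
open import Relation.Binary.PropositionalEquality using (_≡_; _≢_)

record Graph (n : ℕ) : Set where
  field
    adj    : Fin n → Fin n → Bool
    sym    : ∀ u v → adj u v ≡ adj v u
    irrefl : ∀ v → adj v v ≡ false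
open Graph public

E : ∀ {n} → Graph n → Fin n → Fin n → Set
E G u v = adj G u v ≡ true

TriangleFree : ∀ {n} → Graph n → Set
TriangleFree G = ∀ u v w → E G u v → E G v w → E G u w → ⊥

VSet : ℕ → Set
VSet n = Fin n → Bool

In : ∀ {n} → VSet n → Fin n → Set
In S v = S v ≡ true

full : ∀ {n} → VSet n
full _ = true

degIn : ∀ {n} → Graph n → VSet n → Fin n → ℕ
degIn G S v = sum (map (λ w → if S w ∧ adj G v w then 1 else 0) (allFin _))

ConsecIn : ∀ {A : Set} → A → A → List A → Set
ConsecIn {A} u v l =
  Σ (List A) λ xs → Σ (List A) λ ys →
    (l ≡ xs ++ u ∷ v ∷ ys) ⊎ (l ≡ xs ++ v ∷ u ∷ ys)

-- Structure witnessing that the induced subgraph G[S] is (isomorphic to)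
-- a subdivision of K_m.  Branch vertex br i corresponds to vertex i of K_m;
-- for i < j the edge ij of K_m is replaced by the path
--   br i ∷ int i j ++ [ br j ]
-- (int i j = list of internal vertices; the edge is subdivided iff
-- int i j is nonempty).  Values of int i j for ¬ i < j are irrelevant.
record SubdivK {n : ℕ} (G : Graph n) (S : VSet n) (m : ℕ) : Set where
  field
    br       : Fin m → Fin n
    br-inj   : ∀ i j → br i ≡ br j → i ≡ j
    br-in    : ∀ i → In S (br i)
    int      : Fin m → Fin m → List (Fin n)
    int-in   : ∀ i j → i < j → ∀ v → v ∈ int i j → In S v
    path     : ∀ i j → i < j → Linked (E G) (br i ∷ int i j ++ [ br j ])
    int-uniq : ∀ i j → i < j → Unique (int i j)
    int-nobr : ∀ i j → i < j → ∀ k → br k ∉ int i j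
    disjoint : ∀ i j k l → i < j → k < l → ¬ (i ≡ k × j ≡ l) →
                 ∀ v → v ∈ int i j → v ∉ int k l
    cover    : ∀ v → In S v →
                 (∃[ k ] br k ≡ v) ⊎ (∃[ i ] ∃[ j ] (i < j × v ∈ int i j))
    edges    : ∀ u v → In S u → In S v → E G u v →
                 ∃[ i ] ∃[ j ] (i < j × ConsecIn u v (br i ∷ int i j ++ [ br j ]))
open SubdivK public

SamePair : ∀ {m} → Fin m → Fin m → Fin m → Fin m → Set
SamePair i j a b = (i ≡ a × j ≡ b) ⊎ (i ≡ b × j ≡ a)

GoodK4 : ∀ {n} → Graph n → VSet n → Set
GoodK4 G S =
  ∃[ p ] ∃[ q ] ∃[ r ] ∃[ s ]
    ( In S p × In S q × In S r × In S s
    × p ≢ q × p ≢ r × p ≢ s × q ≢ r × q ≢ s × r ≢ s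
    × degIn G S p ≡ 3 × degIn G S q ≡ 3 × degIn G S r ≡ 3 × degIn G S s ≡ 3
    × E G p q × E G p r × ¬ E G p s × ¬ E G q r )

Distinct4 : ∀ {m} → Fin m → Fin m → Fin m → Fin m → Set
Distinct4 a b c d = a ≢ b × a ≢ c × a ≢ d × b ≢ c × b ≢ d × c ≢ d

Pattern : ∀ {n} {G : Graph n} {S : VSet n} {m} → SubdivK G S m →
          (Fin m → Fin m → Set) → Set
Pattern {m = m} sd Cyc =
  ∀ (i j : Fin m) → i < j →
    (Cyc i j → int sd i j ≡ []) × (¬ Cyc i j → int sd i j ≢ [])

TypeA : ∀ {n} {G : Graph n} {S : VSet n} → SubdivK G S 5 → Set
TypeA sd = ∃[ a ] ∃[ b ] ∃[ c ] ∃[ d ]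
  ( Distinct4 a b c d
  × Pattern sd (λ i j → SamePair i j a b ⊎ SamePair i j b c
                      ⊎ SamePair i j c d ⊎ SamePair i j d a) )

TypeB : ∀ {n} {G : Graph n} {S : VSet n} → SubdivK G S 5 → Set
TypeB sd = ∃[ a ] ∃[ b ] ∃[ c ] ∃[ d ] ∃[ e ]
  ( Distinct4 a b c d × a ≢ e × b ≢ e × c ≢ e × d ≢ e
  × Pattern sd (λ i j → SamePair i j a b ⊎ SamePair i j b c
                      ⊎ SamePair i j c d ⊎ SamePair i j d e ⊎ SamePair i j e a) )

{-# OPTIONS --safe #-}
-- Interior vertices of the subdivision paths have degree at most 2, so the degree-3 vertices of an
-- induced K4-subdivision are its branch vertices, and two branch vertices are adjacent exactly when
-- the edge of K5 between them is not subdivided.  Deleting a branch vertex x together with the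
-- interiors of its four paths leaves an induced K4-subdivision whose branch vertices are the other
-- four, so the hypothesis gives, in the graph H induced on the five branch vertices, a vertex p ≠ x
-- with two neighbours q, r ≠ x and a non-neighbour s ≠ x.  Checking all 2¹⁰ graphs on five vertices
-- shows that a triangle-free H with this property for every x is a 4-cycle plus an isolated vertex or
-- a 5-cycle; read back through the adjacency criterion, these are types A and B.

module Submission where

open import Defs
open import Data.Bool using (Bool; true; false; _∧_; not; if_then_else_)
open import Data.Bool.Properties using (∧-conicalˡ; ∧-conicalʳ) renaming (_≟_ to _≟ᵇ_)
open import Data.Empty using (⊥-elim)
open import Data.Fin using (Fin; _<_; punchIn; punchOut)
open import Data.Fin.Patterns using (0F; 1F; 2F; 3F; 4F)
open import Data.Fin.Properties
  using (_≟_; _<?_; all?; any?; <-asym; <⇒≢; ≤∧≢⇒<; punchIn-injective; punchInᵢ≢i;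
         punchIn-mono-≤; punchIn-cancel-≤; punchIn-punchOut)
open import Data.List using (List; []; _∷_; _++_; [_]; _∷ʳ_; map; allFin)
open import Data.List.Membership.Propositional using (_∈_; _∉_)
open import Data.List.Membership.Propositional.Properties using (∈-++⁺ʳ; ∈-++⁻)
open import Data.List.Properties using (∷-injective; ∷-injectiveˡ; ∷-injectiveʳ; ∷ʳ-injectiveʳ; ++-assoc)
open import Data.List.Relation.Unary.All as All using (All; []; _∷_)
open import Data.List.Relation.Unary.All.Properties using (¬Any⇒All¬) renaming (++⁺ to All-++⁺)
open import Data.List.Relation.Unary.AllPairs using ([]; _∷_)
open import Data.List.Relation.Unary.Any as Any using (here; there)
open import Data.List.Relation.Unary.Linked using (Linked; _∷_)
open import Data.List.Relation.Unary.Unique.Propositional using (Unique)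
open import Data.List.Relation.Unary.Unique.Propositional.Properties using (allFin⁺)
  renaming (++⁺ to Unique-++⁺)
open import Data.Nat using (ℕ; zero; suc; _+_; _≤_; z≤n; s≤s)
open import Data.Nat.ListAction using (sum)
import Data.Nat.Properties as ℕ
open import Algebra.Properties.CommutativeSemigroup ℕ.+-commutativeSemigroup using (interchange)
open import Data.Product using (∃-syntax; _×_; _,_; proj₁; proj₂)
open import Data.Sum as Sum using (_⊎_; inj₁; inj₂)
open import Data.Vec using (Vec; []; _∷_)
open import Function using (_∘_)
open import Relation.Nullary using (¬_; Dec; yes; no; does)
open import Relation.Nullary.Decidable
  using (_×-dec_; _⊎-dec_; _→-dec_; ¬?; map′; from-yes; dec-true; dec-false)
open import Relation.Binary.PropositionalEquality as ≡ using (_≡_; _≢_; refl; cong; subst; trans)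

module _ {A : Set} where

  ∈-interior : ∀ {u v z : A} {xs} → v ∈ xs →
               ∃[ pre ] ∃[ a ] ∃[ b ] ∃[ post ] u ∷ xs ++ [ z ] ≡ (pre ∷ʳ a) ++ v ∷ b ∷ post
  ∈-interior {u} {z = z} (here {xs = []} refl) = [] , u , z , [] , refl
  ∈-interior {u} {z = z} (here {xs = y ∷ ys} refl) = [] , u , y , ys ++ [ z ] , refl
  ∈-interior {u} (there {x = x} v∈xs) with pre , a , b , post , eq ← ∈-interior {u = x} v∈xs =
    u ∷ pre , a , b , post , cong (u ∷_) eq

  ∈-path : ∀ {v a b : A} {l} → v ∈ a ∷ l ++ [ b ] → v ≡ a ⊎ v ∈ l ⊎ v ≡ b
  ∈-path (here v≡a) = inj₁ v≡a
  ∈-path {l = l} (there v∈) with ∈-++⁻ l v∈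
  ... | inj₁ v∈l = inj₂ (inj₁ v∈l)
  ... | inj₂ (here v≡b) = inj₂ (inj₂ v≡b)

  consecIn-∈ : ∀ {u v : A} {l} → ConsecIn u v l → u ∈ l × v ∈ l
  consecIn-∈ (xs , _ , inj₁ refl) = ∈-++⁺ʳ xs (here refl) , ∈-++⁺ʳ xs (there (here refl))
  consecIn-∈ (xs , _ , inj₂ refl) = ∈-++⁺ʳ xs (there (here refl)) , ∈-++⁺ʳ xs (here refl)

  Unique-∷-split : ∀ xs xs′ {v : A} {ys ys′} → Unique (xs ++ v ∷ ys) →
                   xs ++ v ∷ ys ≡ xs′ ++ v ∷ ys′ → xs ≡ xs′ × ys ≡ ys′
  Unique-∷-split [] [] _ refl = refl , refl
  Unique-∷-split [] (_ ∷ xs′) (v∉ ∷ _) refl = ⊥-elim (All.lookup v∉ (∈-++⁺ʳ xs′ (here refl)) refl)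
  Unique-∷-split (_ ∷ xs) [] (v∉ ∷ _) refl = ⊥-elim (All.lookup v∉ (∈-++⁺ʳ xs (here refl)) refl)
  Unique-∷-split (x ∷ xs) (_ ∷ xs′) (_ ∷ unique) eq with refl , eq′ ← ∷-injective eq
    with refl , ys≡ys′ ← Unique-∷-split xs xs′ unique eq′ = refl , ys≡ys′

  consecIn-unique : ∀ pre {a v b : A} {post w l} → Unique l → l ≡ (pre ∷ʳ a) ++ v ∷ b ∷ post →
                    ConsecIn v w l → w ≡ a ⊎ w ≡ b
  consecIn-unique pre unique refl (xs , _ , inj₁ eq) =
    inj₂ (≡.sym (∷-injectiveˡ (proj₂ (Unique-∷-split (pre ∷ʳ _) xs unique eq))))
  consecIn-unique pre unique refl (xs , ys , inj₂ eq) =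
    inj₁ (≡.sym (∷ʳ-injectiveʳ pre xs (proj₁
      (Unique-∷-split (pre ∷ʳ _) (xs ∷ʳ _) unique (trans eq (≡.sym (++-assoc xs [ _ ] (_ ∷ ys))))))))

  consecIn-ends : ∀ xs {u v a b : A} {l ys} → u ≢ v → u ∉ l → v ∉ l →
                  a ∷ l ++ [ b ] ≡ xs ++ u ∷ v ∷ ys → l ≡ [] × u ≡ a × v ≡ b
  consecIn-ends [] {l = []} _ _ _ refl = refl , refl , refl
  consecIn-ends [] {l = _ ∷ _} _ _ v∉l refl = ⊥-elim (v∉l (here refl))
  consecIn-ends (_ ∷ xs) {u} {v} {l = l} u≢v u∉l v∉l eq
    with ∈-++⁻ l (subst (u ∈_) tail (∈-++⁺ʳ xs (here refl)))
       | ∈-++⁻ l (subst (v ∈_) tail (∈-++⁺ʳ xs (there (here refl))))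
    where tail = ≡.sym (∷-injectiveʳ eq)
  ... | inj₁ u∈l | _ = ⊥-elim (u∉l u∈l)
  ... | _ | inj₁ v∈l = ⊥-elim (v∉l v∈l)
  ... | inj₂ (here refl) | inj₂ (here refl) = ⊥-elim (u≢v refl)

countTrue : ∀ {A : Set} → (A → Bool) → List A → ℕ
countTrue p l = sum (map (λ w → if p w then 1 else 0) l)

countTrue-≤-+ : ∀ {A : Set} {p q r : A → Bool} (l : List A) →
                (∀ w → p w ≡ true → q w ≡ true ⊎ r w ≡ true) →
                countTrue p l ≤ countTrue q l + countTrue r l
countTrue-≤-+ [] _ = z≤n
countTrue-≤-+ {p = p} {q} {r} (x ∷ l) p⇒q∨r =
  ℕ.≤-trans (ℕ.+-mono-≤ atHead (countTrue-≤-+ l p⇒q∨r))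
            (ℕ.≤-reflexive (interchange (if q x then 1 else 0) (if r x then 1 else 0) _ _))
  where
  atHead : (if p x then 1 else 0) ≤ (if q x then 1 else 0) + (if r x then 1 else 0)
  atHead with p x in px
  ... | false = z≤n
  ... | true with p⇒q∨r x px
  ...   | inj₁ qx rewrite qx = s≤s z≤n
  ...   | inj₂ rx rewrite rx = ℕ.m≤n+m 1 _

countTrue-≟-absent : ∀ {n} {a : Fin n} {l} → All (a ≢_) l → countTrue (λ w → does (w ≟ a)) l ≡ 0
countTrue-≟-absent [] = refl
countTrue-≟-absent {a = a} {x ∷ _} (a≢x ∷ a∉l) rewrite dec-false (x ≟ a) (a≢x ∘ ≡.sym) =
  countTrue-≟-absent a∉l

countTrue-≟-unique : ∀ {n} {a : Fin n} {l} → Unique l → countTrue (λ w → does (w ≟ a)) l ≤ 1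
countTrue-≟-unique [] = z≤n
countTrue-≟-unique {a = a} {x ∷ _} (x∉l ∷ unique) with x ≟ a
... | no _ = countTrue-≟-unique unique
... | yes refl = s≤s (ℕ.≤-reflexive (countTrue-≟-absent x∉l))

degIn≤2 : ∀ {n} (G : Graph n) (S : VSet n) {v} (a b : Fin n) →
          (∀ w → In S w → E G v w → w ≡ a ⊎ w ≡ b) → degIn G S v ≤ 2
degIn≤2 {n} G S {v} a b neighbours =
  ℕ.≤-trans (countTrue-≤-+ (allFin n) isNeighbour)
            (ℕ.+-mono-≤ (countTrue-≟-unique (allFin⁺ n)) (countTrue-≟-unique (allFin⁺ n)))
  where
  isNeighbour : ∀ w → S w ∧ adj G v w ≡ true → does (w ≟ a) ≡ true ⊎ does (w ≟ b) ≡ true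
  isNeighbour w Sw∧vw with neighbours w (∧-conicalˡ _ _ Sw∧vw) (∧-conicalʳ (S w) _ Sw∧vw)
  ... | inj₁ w≡a = inj₁ (dec-true (w ≟ a) w≡a)
  ... | inj₂ w≡b = inj₂ (dec-true (w ≟ b) w≡b)

E⇒≢ : ∀ {n} (G : Graph n) {u v} → E G u v → u ≢ v
E⇒≢ G {u} uv refl with () ← ≡.trans (≡.sym (irrefl G u)) uv

module _ {n m} {G : Graph n} {S : VSet n} (sd : SubdivK G S m) where

  branchPath : Fin m → Fin m → List (Fin n)
  branchPath i j = br sd i ∷ int sd i j ++ [ br sd j ]

  branchPath-unique : ∀ {i j} → i < j → Unique (branchPath i j)
  branchPath-unique {i} {j} i<j =
    All-++⁺ (¬Any⇒All¬ _ (int-nobr sd i j i<j i)) ((<⇒≢ i<j ∘ br-inj sd i j) ∷ [])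
    ∷ Unique-++⁺ (int-uniq sd i j i<j) ([] ∷ []) λ { (v∈int , here refl) → int-nobr sd i j i<j j v∈int }

  interior-on-path : ∀ {i j i′ j′ v} → i < j → i′ < j′ →
                     v ∈ int sd i j → v ∈ branchPath i′ j′ → i ≡ i′ × j ≡ j′
  interior-on-path {i} {j} {i′} {j′} i<j i′<j′ v∈int v∈path with ∈-path v∈path
  ... | inj₁ refl = ⊥-elim (int-nobr sd i j i<j i′ v∈int)
  ... | inj₂ (inj₂ refl) = ⊥-elim (int-nobr sd i j i<j j′ v∈int)
  ... | inj₂ (inj₁ v∈int′) with i ≟ i′ | j ≟ j′
  ...   | yes i≡i′ | yes j≡j′ = i≡i′ , j≡j′
  ...   | no i≢i′ | _ = ⊥-elim (disjoint sd i j i′ j′ i<j i′<j′ (i≢i′ ∘ proj₁) _ v∈int v∈int′)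
  ...   | _ | no j≢j′ = ⊥-elim (disjoint sd i j i′ j′ i<j i′<j′ (j≢j′ ∘ proj₂) _ v∈int v∈int′)

  interior-neighbours : ∀ {i j v} → i < j → v ∈ int sd i j →
                        ∃[ a ] ∃[ b ] (∀ w → In S w → E G v w → w ≡ a ⊎ w ≡ b)
  interior-neighbours {i} {j} {v} i<j v∈int
    with pre , a , b , _ , path≡ ← ∈-interior {u = br sd i} {z = br sd j} v∈int = a , b , neighbour
    where
    neighbour : ∀ w → In S w → E G v w → w ≡ a ⊎ w ≡ b
    neighbour w w∈S vw with i′ , j′ , i′<j′ , consec ← edges sd v w (int-in sd i j i<j v v∈int) w∈S vw
      with refl , refl ← interior-on-path i<j i′<j′ v∈int (proj₁ (consecIn-∈ consec))
      = consecIn-unique pre (branchPath-unique i<j) path≡ consec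

  interior-degIn≤2 : ∀ {i j v} → i < j → v ∈ int sd i j → degIn G S v ≤ 2
  interior-degIn≤2 i<j v∈int with a , b , neighbours ← interior-neighbours i<j v∈int =
    degIn≤2 G S a b neighbours

  3≤degIn⇒branch : ∀ {v} → In S v → 3 ≤ degIn G S v → ∃[ k ] br sd k ≡ v
  3≤degIn⇒branch {v} v∈S 3≤deg with cover sd v v∈S
  ... | inj₁ branch = branch
  ... | inj₂ (_ , _ , i<j , v∈int) =
    ⊥-elim (ℕ.<-irrefl refl (ℕ.≤-trans 3≤deg (interior-degIn≤2 i<j v∈int)))

  unsubdivided⇒adjacent : ∀ {i j} → i < j → int sd i j ≡ [] → E G (br sd i) (br sd j)
  unsubdivided⇒adjacent {i} {j} i<j unsubdivided
    with ij ∷ _ ← subst (λ l → Linked (E G) (br sd i ∷ l ++ [ br sd j ])) unsubdivided (path sd i j i<j)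
    = ij

  adjacent⇒unsubdivided : ∀ {i j} → i < j → E G (br sd i) (br sd j) → int sd i j ≡ []
  adjacent⇒unsubdivided {i} {j} i<j ij with edges sd _ _ (br-in sd i) (br-in sd j) ij
  ... | i′ , j′ , i′<j′ , xs , _ , inj₁ path≡
        with unsubdivided , bi≡ , bj≡ ← consecIn-ends xs (E⇒≢ G ij)
               (int-nobr sd i′ j′ i′<j′ i) (int-nobr sd i′ j′ i′<j′ j) path≡
        with refl ← br-inj sd _ _ bi≡ | refl ← br-inj sd _ _ bj≡ = unsubdivided
  ... | i′ , j′ , i′<j′ , xs , _ , inj₂ path≡
        with _ , bj≡ , bi≡ ← consecIn-ends xs (E⇒≢ G ij ∘ ≡.sym)
               (int-nobr sd i′ j′ i′<j′ j) (int-nobr sd i′ j′ i′<j′ i) path≡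
        with refl ← br-inj sd _ _ bj≡ | refl ← br-inj sd _ _ bi≡ = ⊥-elim (<-asym i<j i′<j′)

punchIn-mono-< : ∀ {m} (x : Fin (suc m)) {i j : Fin m} → i < j → punchIn x i < punchIn x j
punchIn-mono-< x {i} {j} i<j =
  ≤∧≢⇒< (punchIn-mono-≤ x i j (ℕ.<⇒≤ i<j)) (<⇒≢ i<j ∘ punchIn-injective x i j)

punchIn-cancel-< : ∀ {m} (x : Fin (suc m)) {i j : Fin m} → punchIn x i < punchIn x j → i < j
punchIn-cancel-< x {i} {j} lt = ≤∧≢⇒< (punchIn-cancel-≤ x i j (ℕ.<⇒≤ lt)) (<⇒≢ lt ∘ cong (punchIn x))

punchIn-onto : ∀ {m} {x k : Fin (suc m)} → x ≢ k → ∃[ k′ ] punchIn x k′ ≡ k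
punchIn-onto x≢k = punchOut x≢k , punchIn-punchOut x≢k

module _ {n m} {G : Graph n} {S : VSet n} (sd : SubdivK G S (suc m)) (x : Fin (suc m)) where

  InStar : Fin n → Set
  InStar v = v ≡ br sd x ⊎ ∃[ j ] (x < j × v ∈ int sd x j ⊎ j < x × v ∈ int sd j x)

  inStar? : ∀ v → Dec (InStar v)
  inStar? v = v ≟ br sd x ⊎-dec any? λ j →
    (x <? j ×-dec Any.any? (v ≟_) (int sd x j)) ⊎-dec (j <? x ×-dec Any.any? (v ≟_) (int sd j x))

  withoutStar : VSet n
  withoutStar v = S v ∧ not (does (inStar? v))

  withoutStar⁺ : ∀ {v} → In S v → ¬ InStar v → In withoutStar v
  withoutStar⁺ {v} v∈S ¬star rewrite v∈S | dec-false (inStar? v) ¬star = refl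

  withoutStar⁻ : ∀ {v} → In withoutStar v → In S v × ¬ InStar v
  withoutStar⁻ {v} v∈ = ∧-conicalˡ _ _ v∈ , ¬star
    where
    ¬star : ¬ InStar v
    ¬star star with () ← subst (λ b → not b ≡ true) (dec-true (inStar? v) star) (∧-conicalʳ (S v) _ v∈)

  branch∉star : ∀ k → ¬ InStar (br sd (punchIn x k))
  branch∉star k (inj₁ bk≡bx) = punchInᵢ≢i x k (br-inj sd _ _ bk≡bx)
  branch∉star k (inj₂ (j , inj₁ (x<j , bk∈int))) = int-nobr sd x j x<j _ bk∈int
  branch∉star k (inj₂ (j , inj₂ (j<x , bk∈int))) = int-nobr sd j x j<x _ bk∈int

  interior∉star : ∀ {i j v} → i < j → v ∈ int sd (punchIn x i) (punchIn x j) → ¬ InStar v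
  interior∉star i<j v∈int (inj₁ refl) = int-nobr sd _ _ (punchIn-mono-< x i<j) x v∈int
  interior∉star {i} i<j v∈int (inj₂ (k , inj₁ (x<k , v∈int′))) =
    disjoint sd _ _ x k (punchIn-mono-< x i<j) x<k (punchInᵢ≢i x i ∘ proj₁) _ v∈int v∈int′
  interior∉star {j = j} i<j v∈int (inj₂ (k , inj₂ (k<x , v∈int′))) =
    disjoint sd _ _ k x (punchIn-mono-< x i<j) k<x (punchInᵢ≢i x j ∘ proj₂) _ v∈int v∈int′

  star-pathˡ : ∀ {j w} → x < j → w ∈ branchPath sd x j → ¬ InStar w → w ≡ br sd j
  star-pathˡ x<j w∈path ¬star with ∈-path w∈path
  ... | inj₁ w≡bx = ⊥-elim (¬star (inj₁ w≡bx))
  ... | inj₂ (inj₁ w∈int) = ⊥-elim (¬star (inj₂ (_ , inj₁ (x<j , w∈int))))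
  ... | inj₂ (inj₂ w≡bj) = w≡bj

  star-pathʳ : ∀ {i w} → i < x → w ∈ branchPath sd i x → ¬ InStar w → w ≡ br sd i
  star-pathʳ i<x w∈path ¬star with ∈-path w∈path
  ... | inj₁ w≡bi = w≡bi
  ... | inj₂ (inj₁ w∈int) = ⊥-elim (¬star (inj₂ (_ , inj₂ (i<x , w∈int))))
  ... | inj₂ (inj₂ w≡bx) = ⊥-elim (¬star (inj₁ w≡bx))

  deleteBranch : SubdivK G withoutStar m
  deleteBranch = record
    { br       = br sd ∘ punchIn x
    ; br-inj   = λ i j → punchIn-injective x i j ∘ br-inj sd _ _
    ; br-in    = λ k → withoutStar⁺ (br-in sd _) (branch∉star k)
    ; int      = λ i j → int sd (punchIn x i) (punchIn x j)
    ; int-in   = λ i j i<j v v∈int →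
                   withoutStar⁺ (int-in sd _ _ (punchIn-mono-< x i<j) v v∈int) (interior∉star i<j v∈int)
    ; path     = λ i j → path sd _ _ ∘ punchIn-mono-< x
    ; int-uniq = λ i j → int-uniq sd _ _ ∘ punchIn-mono-< x
    ; int-nobr = λ i j i<j k → int-nobr sd _ _ (punchIn-mono-< x i<j) (punchIn x k)
    ; disjoint = λ i j k l i<j k<l other →
                   disjoint sd _ _ _ _ (punchIn-mono-< x i<j) (punchIn-mono-< x k<l)
                   λ (i≡k , j≡l) → other (punchIn-injective x _ _ i≡k , punchIn-injective x _ _ j≡l)
    ; cover    = cover′
    ; edges    = edges′
    }
    where
    branch-survives : ∀ {v} → ¬ InStar v → ∃[ k ] br sd k ≡ v → ∃[ k ] br sd (punchIn x k) ≡ v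
    branch-survives ¬star (k , bk≡v) with x ≟ k
    ... | yes refl = ⊥-elim (¬star (inj₁ (≡.sym bk≡v)))
    ... | no x≢k with k′ , refl ← punchIn-onto x≢k = k′ , bk≡v

    interior-survives : ∀ {v} → ¬ InStar v → ∃[ i ] ∃[ j ] (i < j × v ∈ int sd i j) →
                        ∃[ i ] ∃[ j ] (i < j × v ∈ int sd (punchIn x i) (punchIn x j))
    interior-survives ¬star (i , j , i<j , v∈int) with x ≟ i | x ≟ j
    ... | yes refl | _ = ⊥-elim (¬star (inj₂ (j , inj₁ (i<j , v∈int))))
    ... | _ | yes refl = ⊥-elim (¬star (inj₂ (i , inj₂ (i<j , v∈int))))
    ... | no x≢i | no x≢j with i′ , refl ← punchIn-onto x≢i | j′ , refl ← punchIn-onto x≢j =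
      i′ , j′ , punchIn-cancel-< x i<j , v∈int

    cover′ : ∀ v → In withoutStar v →
             (∃[ k ] br sd (punchIn x k) ≡ v)
             ⊎ (∃[ i ] ∃[ j ] (i < j × v ∈ int sd (punchIn x i) (punchIn x j)))
    cover′ v v∈ with v∈S , ¬star ← withoutStar⁻ v∈ =
      Sum.map (branch-survives ¬star) (interior-survives ¬star) (cover sd v v∈S)

    edges′ : ∀ u v → In withoutStar u → In withoutStar v → E G u v →
             ∃[ i ] ∃[ j ] (i < j × ConsecIn u v (branchPath sd (punchIn x i) (punchIn x j)))
    edges′ u v u∈ v∈ uv with u∈S , ¬star-u ← withoutStar⁻ u∈ | v∈S , ¬star-v ← withoutStar⁻ v∈
      with i , j , i<j , consec ← edges sd u v u∈S v∈S uv
      with u∈path , v∈path ← consecIn-∈ consec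
      with x ≟ i | x ≟ j
    ... | yes refl | _ =
      ⊥-elim (E⇒≢ G uv (trans (star-pathˡ i<j u∈path ¬star-u) (≡.sym (star-pathˡ i<j v∈path ¬star-v))))
    ... | _ | yes refl =
      ⊥-elim (E⇒≢ G uv (trans (star-pathʳ i<j u∈path ¬star-u) (≡.sym (star-pathʳ i<j v∈path ¬star-v))))
    ... | no x≢i | no x≢j with i′ , refl ← punchIn-onto x≢i | j′ , refl ← punchIn-onto x≢j =
      i′ , j′ , punchIn-cancel-< x i<j , consec

Cycle4 : ∀ {m} → Fin m → Fin m → Fin m → Fin m → Fin m → Fin m → Set
Cycle4 a b c d i j = SamePair i j a b ⊎ SamePair i j b c ⊎ SamePair i j c d ⊎ SamePair i j d a

Cycle5 : ∀ {m} → Fin m → Fin m → Fin m → Fin m → Fin m → Fin m → Fin m → Set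
Cycle5 a b c d e i j =
  SamePair i j a b ⊎ SamePair i j b c ⊎ SamePair i j c d ⊎ SamePair i j d e ⊎ SamePair i j e a

samePair? : ∀ {m} (i j a b : Fin m) → Dec (SamePair i j a b)
samePair? i j a b = (i ≟ a ×-dec j ≟ b) ⊎-dec (i ≟ b ×-dec j ≟ a)

cycle4? : ∀ {m} (a b c d i j : Fin m) → Dec (Cycle4 a b c d i j)
cycle4? a b c d i j =
  samePair? i j a b ⊎-dec samePair? i j b c ⊎-dec samePair? i j c d ⊎-dec samePair? i j d a

cycle5? : ∀ {m} (a b c d e i j : Fin m) → Dec (Cycle5 a b c d e i j)
cycle5? a b c d e i j =
  samePair? i j a b ⊎-dec samePair? i j b c ⊎-dec samePair? i j c d
  ⊎-dec samePair? i j d e ⊎-dec samePair? i j e a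

distinct4? : ∀ {m} (a b c d : Fin m) → Dec (Distinct4 a b c d)
distinct4? a b c d = ¬? (a ≟ b) ×-dec ¬? (a ≟ c) ×-dec ¬? (a ≟ d)
                 ×-dec ¬? (b ≟ c) ×-dec ¬? (b ≟ d) ×-dec ¬? (c ≟ d)

module _ {m} (A : Fin m → Fin m → Bool) where

  Adj : Fin m → Fin m → Set
  Adj i j = A i j ≡ true

  NoTriangle : Set
  NoTriangle = ∀ a b c → Adj a b → Adj b c → ¬ Adj a c

  CherryAvoiding : Fin m → Set
  CherryAvoiding x = ∃[ p ] ∃[ q ] ∃[ r ] ∃[ s ]
    ( Distinct4 p q r s × (p ≢ x × q ≢ x × r ≢ x × s ≢ x)
    × Adj p q × Adj p r × ¬ Adj p s × ¬ Adj q r )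

  EdgesExactly : (Fin m → Fin m → Set) → Set
  EdgesExactly Cyc = ∀ i j → i < j → (Cyc i j → Adj i j) × (¬ Cyc i j → ¬ Adj i j)

  FourCycle : Set
  FourCycle = ∃[ a ] ∃[ b ] ∃[ c ] ∃[ d ] (Distinct4 a b c d × EdgesExactly (Cycle4 a b c d))

  FiveCycle : Set
  FiveCycle = ∃[ a ] ∃[ b ] ∃[ c ] ∃[ d ] ∃[ e ]
    ( Distinct4 a b c d × a ≢ e × b ≢ e × c ≢ e × d ≢ e
    × EdgesExactly (Cycle5 a b c d e) )

  adj? : ∀ i j → Dec (Adj i j)
  adj? i j = A i j ≟ᵇ true

  noTriangle? : Dec NoTriangle
  noTriangle? = all? λ a → all? λ b → all? λ c →
    adj? a b →-dec adj? b c →-dec ¬? (adj? a c)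

  -- Choosing the centre first, then its two leaves, then the non-neighbour, prunes the search.
  cherryAvoiding? : ∀ x → Dec (CherryAvoiding x)
  cherryAvoiding? x = map′
    (λ (p , p≢x , q , (q≢x , p≢q , pq) , r , (r≢x , p≢r , q≢r , pr , ¬qr)
          , s , (s≢x , p≢s , q≢s , r≢s , ¬ps)) →
       p , q , r , s , (p≢q , p≢r , p≢s , q≢r , q≢s , r≢s) , (p≢x , q≢x , r≢x , s≢x)
       , pq , pr , ¬ps , ¬qr)
    (λ (p , q , r , s , (p≢q , p≢r , p≢s , q≢r , q≢s , r≢s) , (p≢x , q≢x , r≢x , s≢x)
          , pq , pr , ¬ps , ¬qr) →
       p , p≢x , q , (q≢x , p≢q , pq) , r , (r≢x , p≢r , q≢r , pr , ¬qr)
       , s , (s≢x , p≢s , q≢s , r≢s , ¬ps))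
    (any? λ p → ¬? (p ≟ x) ×-dec
     any? λ q → (¬? (q ≟ x) ×-dec ¬? (p ≟ q) ×-dec adj? p q) ×-dec
     any? λ r → (¬? (r ≟ x) ×-dec ¬? (p ≟ r) ×-dec ¬? (q ≟ r) ×-dec adj? p r ×-dec ¬? (adj? q r)) ×-dec
     any? λ s → ¬? (s ≟ x) ×-dec ¬? (p ≟ s) ×-dec ¬? (q ≟ s) ×-dec ¬? (r ≟ s) ×-dec ¬? (adj? p s))

  edgesExactly? : ∀ {Cyc} → (∀ i j → Dec (Cyc i j)) → Dec (EdgesExactly Cyc)
  edgesExactly? cyc? = all? λ i → all? λ j → i <? j →-dec
    (cyc? i j →-dec adj? i j) ×-dec (¬? (cyc? i j) →-dec ¬? (adj? i j))

  fourCycle? : Dec FourCycle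
  fourCycle? = any? λ a → any? λ b → any? λ c → any? λ d →
    distinct4? a b c d ×-dec edgesExactly? (cycle4? a b c d)

  fiveCycle? : Dec FiveCycle
  fiveCycle? = any? λ a → any? λ b → any? λ c → any? λ d → any? λ e →
    distinct4? a b c d ×-dec ¬? (a ≟ e) ×-dec ¬? (b ≟ e) ×-dec ¬? (c ≟ e) ×-dec ¬? (d ≟ e)
    ×-dec edgesExactly? (cycle5? a b c d e)

module _ {m} {A B : Fin m → Fin m → Bool} (A≗B : ∀ i j → A i j ≡ B i j) where

  Adj-resp : ∀ {i j} → Adj A i j → Adj B i j
  Adj-resp {i} {j} = trans (≡.sym (A≗B i j))

  ¬Adj-resp : ∀ {i j} → ¬ Adj A i j → ¬ Adj B i j
  ¬Adj-resp {i} {j} ¬ij = ¬ij ∘ trans (A≗B i j)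

  noTriangle-resp : NoTriangle B → NoTriangle A
  noTriangle-resp noTriangle a b c ab bc = noTriangle a b c (Adj-resp ab) (Adj-resp bc) ∘ Adj-resp

  cherryAvoiding-resp : ∀ {x} → CherryAvoiding A x → CherryAvoiding B x
  cherryAvoiding-resp (p , q , r , s , distinct , avoid , pq , pr , ¬ps , ¬qr) =
    p , q , r , s , distinct , avoid , Adj-resp pq , Adj-resp pr , ¬Adj-resp ¬ps , ¬Adj-resp ¬qr

  edgesExactly-resp : ∀ {Cyc} → EdgesExactly A Cyc → EdgesExactly B Cyc
  edgesExactly-resp exact i j i<j = Adj-resp ∘ proj₁ (exact i j i<j) , ¬Adj-resp ∘ proj₂ (exact i j i<j)

  fourCycle-resp : FourCycle A → FourCycle B
  fourCycle-resp (a , b , c , d , distinct , exact) = a , b , c , d , distinct , edgesExactly-resp exact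

  fiveCycle-resp : FiveCycle A → FiveCycle B
  fiveCycle-resp (a , b , c , d , e , distinct , a≢e , b≢e , c≢e , d≢e , exact) =
    a , b , c , d , e , distinct , a≢e , b≢e , c≢e , d≢e , edgesExactly-resp exact

edgeBit : Vec Bool 10 → Fin 5 → Fin 5 → Bool
edgeBit (b₀₁ ∷ b₀₂ ∷ b₀₃ ∷ b₀₄ ∷ b₁₂ ∷ b₁₃ ∷ b₁₄ ∷ b₂₃ ∷ b₂₄ ∷ b₃₄ ∷ []) = bit
  where
  bit : Fin 5 → Fin 5 → Bool
  bit 0F 1F = b₀₁
  bit 0F 2F = b₀₂
  bit 0F 3F = b₀₃
  bit 0F 4F = b₀₄
  bit 1F 2F = b₁₂
  bit 1F 3F = b₁₃
  bit 1F 4F = b₁₄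
  bit 2F 3F = b₂₃
  bit 2F 4F = b₂₄
  bit 3F 4F = b₃₄
  bit 1F 0F = b₀₁
  bit 2F 0F = b₀₂
  bit 3F 0F = b₀₃
  bit 4F 0F = b₀₄
  bit 2F 1F = b₁₂
  bit 3F 1F = b₁₃
  bit 4F 1F = b₁₄
  bit 3F 2F = b₂₃
  bit 4F 2F = b₂₄
  bit 4F 3F = b₃₄
  bit _ _ = false

table : (Fin 5 → Fin 5 → Bool) → Vec Bool 10
table A = A 0F 1F ∷ A 0F 2F ∷ A 0F 3F ∷ A 0F 4F ∷ A 1F 2F
        ∷ A 1F 3F ∷ A 1F 4F ∷ A 2F 3F ∷ A 2F 4F ∷ A 3F 4F ∷ []

edgeBit-table : (H : Graph 5) → ∀ i j → edgeBit (table (adj H)) i j ≡ adj H i j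
edgeBit-table H 0F 1F = refl
edgeBit-table H 0F 2F = refl
edgeBit-table H 0F 3F = refl
edgeBit-table H 0F 4F = refl
edgeBit-table H 1F 2F = refl
edgeBit-table H 1F 3F = refl
edgeBit-table H 1F 4F = refl
edgeBit-table H 2F 3F = refl
edgeBit-table H 2F 4F = refl
edgeBit-table H 3F 4F = refl
edgeBit-table H 1F 0F = sym H 0F 1F
edgeBit-table H 2F 0F = sym H 0F 2F
edgeBit-table H 3F 0F = sym H 0F 3F
edgeBit-table H 4F 0F = sym H 0F 4F
edgeBit-table H 2F 1F = sym H 1F 2F
edgeBit-table H 3F 1F = sym H 1F 3F
edgeBit-table H 4F 1F = sym H 1F 4F
edgeBit-table H 3F 2F = sym H 2F 3F
edgeBit-table H 4F 2F = sym H 2F 4F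
edgeBit-table H 4F 3F = sym H 3F 4F
edgeBit-table H 0F 0F = ≡.sym (irrefl H 0F)
edgeBit-table H 1F 1F = ≡.sym (irrefl H 1F)
edgeBit-table H 2F 2F = ≡.sym (irrefl H 2F)
edgeBit-table H 3F 3F = ≡.sym (irrefl H 3F)
edgeBit-table H 4F 4F = ≡.sym (irrefl H 4F)

∀-Vec? : ∀ n {P : Vec Bool n → Set} → (∀ v → Dec (P v)) → Dec (∀ v → P v)
∀-Vec? zero P? = map′ (λ { p [] → p }) (λ p → p []) (P? [])
∀-Vec? (suc n) P? =
  map′ (λ { (p , _) (true ∷ v) → p v ; (_ , p) (false ∷ v) → p v })
       (λ p → (λ v → p (true ∷ v)) , (λ v → p (false ∷ v)))
       (∀-Vec? n (P? ∘ (true ∷_)) ×-dec ∀-Vec? n (P? ∘ (false ∷_)))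

Classified : (Fin 5 → Fin 5 → Bool) → Set
Classified A = NoTriangle A → (∀ x → CherryAvoiding A x) → FourCycle A ⊎ FiveCycle A

classified? : ∀ A → Dec (Classified A)
classified? A = noTriangle? A →-dec all? (cherryAvoiding? A) →-dec (fourCycle? A ⊎-dec fiveCycle? A)

edgeBit-classified : ∀ t → Classified (edgeBit t)
edgeBit-classified = from-yes (∀-Vec? 10 (classified? ∘ edgeBit))

graph5-classified : (H : Graph 5) → Classified (adj H)
graph5-classified H noTriangle cherries =
  Sum.map (fourCycle-resp tableH) (fiveCycle-resp tableH)
    (edgeBit-classified (table (adj H)) (noTriangle-resp tableH noTriangle)
      (cherryAvoiding-resp (λ i j → ≡.sym (tableH i j)) ∘ cherries))
  where
  tableH : ∀ i j → edgeBit (table (adj H)) i j ≡ adj H i j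
  tableH = edgeBit-table H

branchGraph : ∀ {n m} {G : Graph n} {S : VSet n} → SubdivK G S m → Graph m
branchGraph {G = G} sd = record
  { adj    = λ i j → adj G (br sd i) (br sd j)
  ; sym    = λ i j → sym G (br sd i) (br sd j)
  ; irrefl = λ i → irrefl G (br sd i)
  }

branchGraph-triangleFree : ∀ {n m} {G : Graph n} {S : VSet n} (sd : SubdivK G S m) →
                           TriangleFree G → TriangleFree (branchGraph sd)
branchGraph-triangleFree sd triangleFree a b c = triangleFree (br sd a) (br sd b) (br sd c)

branchGraph-cherryAvoiding : ∀ {n} {G : Graph n} {S : VSet n} → (∀ S′ → SubdivK G S′ 4 → GoodK4 G S′) →
                             (sd : SubdivK G S 5) → ∀ x → CherryAvoiding (adj (branchGraph sd)) x
branchGraph-cherryAvoiding goodK4 sd x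
  with p , q , r , s , p∈ , q∈ , r∈ , s∈ , p≢q , p≢r , p≢s , q≢r , q≢s , r≢s
     , dp , dq , dr , ds , pq , pr , ¬ps , ¬qr
       ← goodK4 _ (deleteBranch sd x)
  with kp , refl ← 3≤degIn⇒branch (deleteBranch sd x) p∈ (ℕ.≤-reflexive (≡.sym dp))
     | kq , refl ← 3≤degIn⇒branch (deleteBranch sd x) q∈ (ℕ.≤-reflexive (≡.sym dq))
     | kr , refl ← 3≤degIn⇒branch (deleteBranch sd x) r∈ (ℕ.≤-reflexive (≡.sym dr))
     | ks , refl ← 3≤degIn⇒branch (deleteBranch sd x) s∈ (ℕ.≤-reflexive (≡.sym ds))
  = punchIn x kp , punchIn x kq , punchIn x kr , punchIn x ks
  , ( p≢q ∘ cong (br sd) , p≢r ∘ cong (br sd) , p≢s ∘ cong (br sd)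
    , q≢r ∘ cong (br sd) , q≢s ∘ cong (br sd) , r≢s ∘ cong (br sd) )
  , (punchInᵢ≢i x kp , punchInᵢ≢i x kq , punchInᵢ≢i x kr , punchInᵢ≢i x ks)
  , pq , pr , ¬ps , ¬qr

edgesExactly⇒Pattern : ∀ {n m} {G : Graph n} {S : VSet n} (sd : SubdivK G S m) {Cyc} →
                       EdgesExactly (adj (branchGraph sd)) Cyc → Pattern sd Cyc
edgesExactly⇒Pattern sd exact i j i<j =
  adjacent⇒unsubdivided sd i<j ∘ proj₁ (exact i j i<j) ,
  λ ¬cyc → proj₂ (exact i j i<j) ¬cyc ∘ unsubdivided⇒adjacent sd i<j

mainTheorem9 : ∀ (n : ℕ) (G : Graph n) →
    TriangleFree G →
    (sd : SubdivK G full 5) →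
    (∀ (S : VSet n) → SubdivK G S 4 → GoodK4 G S) →
    TypeA sd ⊎ TypeB sd
mainTheorem9 n G triangleFree sd goodK4 =
  Sum.map
    (λ (a , b , c , d , distinct , exact) → a , b , c , d , distinct , edgesExactly⇒Pattern sd exact)
    (λ (a , b , c , d , e , distinct , a≢e , b≢e , c≢e , d≢e , exact) →
       a , b , c , d , e , distinct , a≢e , b≢e , c≢e , d≢e , edgesExactly⇒Pattern sd exact)
    (graph5-classified (branchGraph sd) (branchGraph-triangleFree sd triangleFree)
      (branchGraph-cherryAvoiding goodK4 sd))
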